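{- Let $k$ be a power of $2$, let $p_1,\dots,p_k,p'_1,\dots,p'_k,q$ be distinct primes congruent to $1$ modulo $4$ such that each $p_i$ and each $p'_i$ is a quadratic residue modulo $q$ and $q>2\sqrt{\prod_ip_i}$, $q>2\sqrt{\prod_ip'_i}$; let $\Gamma=\mathrm{PSL}(2,\mathbb{F}_q)$, $A_i=\widetilde A(p_i)$, $A'_i=\widetilde A(p'_i)$ (these are cubical generating sets of $\Gamma$), $X=\mathrm{Cay}(\Gamma;(A_1,\dots,A_k))$, $X'=\mathrm{Cay}(\Gamma;(A'_1,\dots,A'_k))$. Let $M=\Gamma\times\mathcal{H}_k$. Let $\mathcal{S}_L=\{\ell_1,\dots,\ell_{D_L}\}$ be a set of distinct signatures of faces of $X$ and $\mathcal{S}_R=\{r_1,\dots,r_{D_R}\}$ a set of distinct signatures of faces of $X'$, and let $L=\{f\in X(k):\mathrm{Signature}(f)\in\mathcal{S}_L\}$, $R=\{f\in X'(k):\mathrm{Signature}(f)\in\mathcal{S}_R\}$. For $u\in M$ let $\mathrm{LNbr}_u(i)$ be the unique $f\in L$ containing $u$ with signature $\ell_i$, and $\mathrm{RNbr}_u(j)$ the unique $f\in R$ containing $u$ with signature $r_j$. Let $H$ be any bipartite graph with left vertex set $[D_L]$ and right vertex set $[D_R]$, and let $Z$ be the bipartite (multi)graph on $L\cup R$ with one edge between $\mathrm{LNbr}_u(i)$ and $\mathrm{RNbr}_u(j)$ for each $u\in M$ and each edge $(i,j)$ of $H$. Then $\Gamma$ acts freely on $Z$ by graph automorphisms via $\gamma\cdot\{(f_x,x)\}_{x}=\{(\gamma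 f_x,x)\}_x$ on vertices: this map sends $L$ to $L$ and $R$ to $R$, it maps the edge of $Z$ indexed by $(u,i,j)$ to the edge indexed by $(\gamma u,i,j)$ where $\gamma(g,x)=(\gamma g,x)$, and no non-identity $\gamma$ fixes any vertex.
   Context: Cubical complex: for cubical generating sets $A_1,\dots,A_k$ of a finite group $\Gamma$ (each closed under inverses, $A_iA_j=A_jA_i$ for $i\ne j$, $|A_1\cdots A_k|=\prod|A_i|$), $X=\mathrm{Cay}(\Gamma;(A_1,\dots,A_k))$ has vertices $\Gamma\times\{0,1\}^k$ and $k$-faces $f=\{(f_x,x)\}_{x\in\{0,1\}^k}$ with $f_x^{ -1}f_{x\oplus e_i}\in A_i$ for all $x,i$. The signature of $f$ is the labeling of directed hypercube edges $(x,x\oplus e_i)$ by $f_x^{ -1}f_{x\oplus e_i}$. $\mathcal{H}_k$ is the Hadamard code in $\{0,1\}^k$ ($k=2^r$, codewords $(\langle a,y\rangle)_{y\in\mathbb{F}_2^r}$). LPS sets: with $\mathbf{i}=\begin{pmatrix}i&0\\0&-i\end{pmatrix}$, $\mathbf{j}=\begin{pmatrix}0&1\\-1&0\end{pmatrix}$, $\mathbf{k}=\begin{pmatrix}0&i\\i&0\end{pmatrix}$, $A(p)$ is the set of integral quaternions $\alpha=a\,\mathrm{id}+b\mathbf{i}+c\mathbf{j}+d\mathbf{k}$ with $a^2+b^2+c^2+d^2=p$ and $a$ odd, modulo $\alpha\sim-\alpha$; fixing $j\in\mathbb{F}_q$ with $j^2=-1$ and $c\in\mathbb{F}_q$ with $c^2p=1$,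 $\widetilde\alpha\in\mathrm{PSL}(2,\mathbb{F}_q)$ is the class of $c$ times $\alpha$ with $i$ replaced by $j$ and entries reduced mod $q$; $\widetilde A(p)=\{\widetilde\alpha:\alpha\in A(p)\}$. A free action is one in which only the identity fixes any vertex. -}

module Defs where

open import Data.Nat as ℕ using (ℕ; zero; suc; _%_; _/_; _≡ᵇ_)
open import Data.Integer using (ℤ; +_; _+_; _*_; -_; _-_)
open import Data.Integer.Divisibility using () renaming (_∣_ to _∣ℤ_)
open import Data.Bool using (Bool; true; false; not; _xor_; _∧_)
open import Data.Vec using (Vec; []; _∷_; lookup; updateAt; tabulate)
open import Data.Fin using (Fin; toℕ)
open import Data.Product using (Σ; ∃; _×_; _,_; proj₁; proj₂)
open import Data.Sum using (_⊎_)
open import Relation.Binary.PropositionalEquality using (_≡_)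

infix 4 _≡[_]_ _≈M[_]_ _~[_]_ _≈F[_]_ _≈S[_]_

_≡[_]_ : ℤ → ℕ → ℤ → Set
a ≡[ q ] b = (+ q) ∣ℤ (a - b)

-- 2x2 integer matrices; PSL(2,F_q) is the set of matrices with
-- determinant ≡ 1 (mod q), up to the equivalence  M ~ N  iff
-- M ≡ N or M ≡ -N entrywise mod q.

record Mat : Set where
  constructor mat
  field
    m₁₁ m₁₂ m₂₁ m₂₂ : ℤ
open Mat public

_⊗_ : Mat → Mat → Mat
mat a b c d ⊗ mat a' b' c' d' =
  mat (a * a' + b * c') (a * b' + b * d') (c * a' + d * c') (c * b' + d * d')

negM : Mat → Mat
negM (mat a b c d) = mat (- a) (- b) (- c) (- d)

-- adjugate; this is the inverse of a matrix of determinant 1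
inv : Mat → Mat
inv (mat a b c d) = mat d (- b) (- c) a

det : Mat → ℤ
det (mat a b c d) = a * d - b * c

I : Mat
I = mat (+ 1) (+ 0) (+ 0) (+ 1)

InSL : ℕ → Mat → Set
InSL q M = det M ≡[ q ] + 1

_≈M[_]_ : Mat → ℕ → Mat → Set
M ≈M[ q ] N = (m₁₁ M ≡[ q ] m₁₁ N) × (m₁₂ M ≡[ q ] m₁₂ N)
            × (m₂₁ M ≡[ q ] m₂₁ N) × (m₂₂ M ≡[ q ] m₂₂ N)

_~[_]_ : Mat → ℕ → Mat → Set
M ~[ q ] N = (M ≈M[ q ] N) ⊎ (M ≈M[ q ] negM N)

-- LPS generating sets  Ã(p) ⊆ PSL(2,F_q)
-- j0 : a square root of -1 mod q ; c0 : an element with c0² p ≡ 1 mod q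

IsOdd : ℤ → Set
IsOdd a = ∃ λ t → a ≡ + 1 + + 2 * t

-- c0 · (a id + b i + c j + d k) with i replaced by j0
quatMat : ℤ → ℤ → ℤ → ℤ → ℤ → ℤ → Mat
quatMat j0 c0 a b c d =
  mat (c0 * (a + b * j0)) (c0 * (c + d * j0))
      (c0 * (- c + d * j0)) (c0 * (a - b * j0))

-- g ∈ Ã(p)  (the identification α ∼ -α is absorbed by ~ in PSL)
InLPS : (q : ℕ) (j0 c0 : ℤ) (p : ℕ) → Mat → Set
InLPS q j0 c0 p g =
  Σ ℤ λ a → Σ ℤ λ b → Σ ℤ λ c → Σ ℤ λ d →
    ((a * a + b * b + c * c + d * d) ≡ + p) × IsOdd a
    × (g ~[ q ] quatMat j0 c0 a b c d)

Cube : ℕ → Set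
Cube k = Vec Bool k

flip : {k : ℕ} → Cube k → Fin k → Cube k
flip x i = updateAt x i not

-- binary expansion (r bits) of a natural number: identifies Fin (2^r) with F_2^r
bits : (r : ℕ) → ℕ → Vec Bool r
bits zero    n = []
bits (suc r) n = (n % 2 ≡ᵇ 1) ∷ bits r (n / 2)

inner : {r : ℕ} → Vec Bool r → Vec Bool r → Bool
inner []       []       = false
inner (a ∷ as) (y ∷ ys) = (a ∧ y) xor inner as ys

IsHadamard : (r : ℕ) → Cube (2 ℕ.^ r) → Set
IsHadamard r x =
  ∃ λ (a : Vec Bool r) → x ≡ tabulate (λ i → inner a (bits r (toℕ i)))

-- Faces of Cay(Γ;(A_1,…,A_k)), represented by f : {0,1}^k → Γ
-- (the face is {(f_x,x)}_x); faces are equal iff pointwise equal in PSL.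

Face : ℕ → Set
Face k = Cube k → Mat

IsFace : (q k : ℕ) → (Fin k → Mat → Set) → Face k → Set
IsFace q k A f = (∀ x → InSL q (f x)) × (∀ x i → A i (inv (f x) ⊗ f (flip x i)))

_≈F[_]_ : {k : ℕ} → Face k → ℕ → Face k → Set
f ≈F[ q ] g = ∀ x → f x ~[ q ] g x

-- signatures: labels of directed edges (x, x ⊕ e_i)
Sig : ℕ → Set
Sig k = Cube k → Fin k → Mat

sig : {k : ℕ} → Face k → Sig k
sig f x i = inv (f x) ⊗ f (flip x i)

_≈S[_]_ : {k : ℕ} → Sig k → ℕ → Sig k → Set
σ ≈S[ q ] τ = ∀ x i → σ x i ~[ q ] τ x i

IsSigOfFace : (q k : ℕ) → (Fin k → Mat → Set) → Sig k → Set
IsSigOfFace q k A σ = ∃ λ f → IsFace q k A f × (sig f ≈S[ q ] σ)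

InSide : (q k : ℕ) → (Fin k → Mat → Set) → {D : ℕ} → (Fin D → Sig k) → Face k → Set
InSide q k A S f = IsFace q k A f × ∃ λ i → sig f ≈S[ q ] S i

Vtx : ℕ → Set
Vtx k = Mat × Cube k

IsNbr : (q k : ℕ) → (Fin k → Mat → Set) → {D : ℕ} → (Fin D → Sig k)
      → Vtx k → Fin D → Face k → Set
IsNbr q k A S u i f =
  IsFace q k A f × (f (proj₂ u) ~[ q ] proj₁ u) × (sig f ≈S[ q ] S i)

InM : (q r : ℕ) → Vtx (2 ℕ.^ r) → Set
InM q r u = InSL q (proj₁ u) × IsHadamard r (proj₂ u)

actF : {k : ℕ} → Mat → Face k → Face k
actF γ f x = γ ⊗ f x

actV : {k : ℕ} → Mat → Vtx k → Vtx k
actV γ (g , x) = (γ ⊗ g , x)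

{-# OPTIONS --safe #-}
module Submission where

open import Defs
open import Data.Bool using (Bool; true; false)
open import Data.Fin using (Fin)
open import Data.Integer as ℤ using (ℤ; +_; -_; 0ℤ; _+_; _-_) renaming (_*_ to _·_)
open import Data.Integer.Divisibility.Signed
  using (divides; ∣ᵤ⇒∣; ∣⇒∣ᵤ; ∣m⇒∣-m; ∣m∣n⇒∣m+n; ∣m⇒∣m*n; ∣n⇒∣m*n)
  renaming (_∣_ to _∣ₛ_)
open import Data.Integer.Properties using (+-inverseʳ)
open import Data.Integer.Tactic.RingSolver using (solve; solve-∀)
open import Data.List using (tabulate; _∷_; [])
open import Data.Nat using (ℕ; _^_; _%_; _<_; _*_)
open import Data.Nat.ListAction using (product)
open import Data.Nat.Primality using (Prime)
open import Data.Product using (Σ; ∃; _×_; _,_)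
open import Data.Sum using (_⊎_; inj₁; inj₂)
open import Data.Vec using (replicate)
open import Relation.Binary.Bundles using (Setoid)
open import Relation.Binary.Definitions using (_Respects_)
open import Relation.Binary.PropositionalEquality using (_≡_; _≢_; refl; sym; cong; subst)
import Relation.Binary.Reasoning.Setoid as SetoidReasoning

-- Γ acts on the left, whereas the face conditions and the signature only
-- involve the quotients f_x⁻¹ f_{x⊕e_i}, which left multiplication leaves
-- unchanged; so γ preserves faces, signatures, L, R and neighbourhoods.
-- Freeness: γ f_x = ± f_x with f_x invertible forces γ = ± I.  Beyond
-- γ ∈ SL(2), only the closure of each Ã(p) under congruence mod q is used;
-- the hypotheses on the primes, on the signatures and on H merely make the
-- objects of the statement meaningful.

-- _≡[_]_ and _≈M[_]_ unfold to divisibility of differences, so their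
-- arguments cannot be inferred: lemmas take them explicitly.
module _ {q : ℕ} where

  private
    ∣-difference⇒≡mod : ∀ a b {x} → + q ∣ₛ x → x ≡ a - b → a ≡[ q ] b
    ∣-difference⇒≡mod _ _ q∣x refl = ∣⇒∣ᵤ q∣x

    ≡mod⇒∣-difference : ∀ a b → a ≡[ q ] b → + q ∣ₛ (a - b)
    ≡mod⇒∣-difference _ _ = ∣ᵤ⇒∣

  mod-refl : ∀ a → a ≡[ q ] a
  mod-refl a = ∣-difference⇒≡mod a a (divides 0ℤ refl) (sym (+-inverseʳ a))

  mod-sym : ∀ a b → a ≡[ q ] b → b ≡[ q ] a
  mod-sym a b a≡b =
    ∣-difference⇒≡mod b a (∣m⇒∣-m (≡mod⇒∣-difference a b a≡b)) (solve (a ∷ b ∷ []))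

  mod-trans : ∀ a b c → a ≡[ q ] b → b ≡[ q ] c → a ≡[ q ] c
  mod-trans a b c a≡b b≡c = ∣-difference⇒≡mod a c
    (∣m∣n⇒∣m+n (≡mod⇒∣-difference a b a≡b) (≡mod⇒∣-difference b c b≡c))
    (solve (a ∷ b ∷ c ∷ []))

  mod-+-cong : ∀ a b c d → a ≡[ q ] b → c ≡[ q ] d → a + c ≡[ q ] b + d
  mod-+-cong a b c d a≡b c≡d = ∣-difference⇒≡mod (a + c) (b + d)
    (∣m∣n⇒∣m+n (≡mod⇒∣-difference a b a≡b) (≡mod⇒∣-difference c d c≡d))
    (solve (a ∷ b ∷ c ∷ d ∷ []))

  mod-*-cong : ∀ a b c d → a ≡[ q ] b → c ≡[ q ] d → a · c ≡[ q ] b · d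
  mod-*-cong a b c d a≡b c≡d = ∣-difference⇒≡mod (a · c) (b · d)
    (∣m∣n⇒∣m+n (∣m⇒∣m*n c (≡mod⇒∣-difference a b a≡b))
               (∣n⇒∣m*n b (≡mod⇒∣-difference c d c≡d)))
    (solve (a ∷ b ∷ c ∷ d ∷ []))

  mod-neg-cong : ∀ a b → a ≡[ q ] b → - a ≡[ q ] - b
  mod-neg-cong a b a≡b =
    ∣-difference⇒≡mod (- a) (- b) (∣m⇒∣-m (≡mod⇒∣-difference a b a≡b)) (solve (a ∷ b ∷ []))

mat-≡ : ∀ {a b c d a′ b′ c′ d′} →
        a ≡ a′ → b ≡ b′ → c ≡ c′ → d ≡ d′ → mat a b c d ≡ mat a′ b′ c′ d′
mat-≡ refl refl refl refl = refl

scalar : ℤ → Mat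
scalar d = mat d 0ℤ 0ℤ d

⊗-assoc : ∀ A B C → (A ⊗ B) ⊗ C ≡ A ⊗ (B ⊗ C)
⊗-assoc (mat a b c d) (mat e f g h) (mat i j k l) =
  mat-≡ (entry a b e f g h i k) (entry a b e f g h j l)
        (entry c d e f g h i k) (entry c d e f g h j l)
  where
  entry : ∀ a b e f g h i k →
          (a · e + b · g) · i + (a · f + b · h) · k
          ≡ a · (e · i + f · k) + b · (g · i + h · k)
  entry = solve-∀

⊗-identityˡ : ∀ A → I ⊗ A ≡ A
⊗-identityˡ (mat a b c d) = mat-≡ (first a c) (first b d) (second a c) (second b d)
  where
  first : ∀ x y → + 1 · x + 0ℤ · y ≡ x
  first = solve-∀
  second : ∀ x y → 0ℤ · x + + 1 · y ≡ y
  second = solve-∀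

⊗-identityʳ : ∀ A → A ⊗ I ≡ A
⊗-identityʳ (mat a b c d) = mat-≡ (first a b) (second a b) (first c d) (second c d)
  where
  first : ∀ x y → x · + 1 + y · 0ℤ ≡ x
  first = solve-∀
  second : ∀ x y → x · 0ℤ + y · + 1 ≡ y
  second = solve-∀

inv-⊗ˡ : ∀ A → inv A ⊗ A ≡ scalar (det A)
inv-⊗ˡ (mat a b c d) = mat-≡ (entry₁₁ a b c d) (entry₁₂ b d) (entry₂₁ a c) (entry₂₂ a b c d)
  where
  entry₁₁ : ∀ a b c d → d · a + - b · c ≡ a · d - b · c
  entry₁₁ = solve-∀
  entry₁₂ : ∀ b d → d · b + - b · d ≡ 0ℤ
  entry₁₂ = solve-∀
  entry₂₁ : ∀ a c → - c · a + a · c ≡ 0ℤ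
  entry₂₁ = solve-∀
  entry₂₂ : ∀ a b c d → - c · b + a · d ≡ a · d - b · c
  entry₂₂ = solve-∀

inv-⊗ʳ : ∀ A → A ⊗ inv A ≡ scalar (det A)
inv-⊗ʳ (mat a b c d) = mat-≡ (entry₁₁ a b c d) (entry₁₂ a b) (entry₂₁ c d) (entry₂₂ a b c d)
  where
  entry₁₁ : ∀ a b c d → a · d + b · - c ≡ a · d - b · c
  entry₁₁ = solve-∀
  entry₁₂ : ∀ a b → a · - b + b · a ≡ 0ℤ
  entry₁₂ = solve-∀
  entry₂₁ : ∀ c d → c · d + d · - c ≡ 0ℤ
  entry₂₁ = solve-∀
  entry₂₂ : ∀ a b c d → c · - b + d · a ≡ a · d - b · c
  entry₂₂ = solve-∀

inv-anti-homo-⊗ : ∀ A B → inv (A ⊗ B) ≡ inv B ⊗ inv A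
inv-anti-homo-⊗ (mat a b c d) (mat a′ b′ c′ d′) =
  mat-≡ (entry₁₁ c d b′ d′) (entry₁₂ a b b′ d′) (entry₂₁ c d a′ c′) (entry₂₂ a b a′ c′)
  where
  entry₁₁ : ∀ c d b′ d′ → c · b′ + d · d′ ≡ d′ · d + - b′ · - c
  entry₁₁ = solve-∀
  entry₁₂ : ∀ a b b′ d′ → - (a · b′ + b · d′) ≡ d′ · - b + - b′ · a
  entry₁₂ = solve-∀
  entry₂₁ : ∀ c d a′ c′ → - (c · a′ + d · c′) ≡ - c′ · d + a′ · - c
  entry₂₁ = solve-∀
  entry₂₂ : ∀ a b a′ c′ → a · a′ + b · c′ ≡ - c′ · - b + a′ · a
  entry₂₂ = solve-∀

det-⊗ : ∀ A B → det (A ⊗ B) ≡ det A · det B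
det-⊗ (mat a b c d) (mat a′ b′ c′ d′) = binet a b c d a′ b′ c′ d′
  where
  binet : ∀ a b c d a′ b′ c′ d′ →
          (a · a′ + b · c′) · (c · b′ + d · d′) - (a · b′ + b · d′) · (c · a′ + d · c′)
          ≡ (a · d - b · c) · (a′ · d′ - b′ · c′)
  binet = solve-∀

⊗-negMˡ : ∀ A B → negM A ⊗ B ≡ negM (A ⊗ B)
⊗-negMˡ (mat a b c d) (mat a′ b′ c′ d′) =
  mat-≡ (entry a b a′ c′) (entry a b b′ d′) (entry c d a′ c′) (entry c d b′ d′)
  where
  entry : ∀ x y z w → - x · z + - y · w ≡ - (x · z + y · w)
  entry = solve-∀

⊗-negMʳ : ∀ A B → A ⊗ negM B ≡ negM (A ⊗ B)
⊗-negMʳ (mat a b c d) (mat a′ b′ c′ d′) =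
  mat-≡ (entry a b a′ c′) (entry a b b′ d′) (entry c d a′ c′) (entry c d b′ d′)
  where
  entry : ∀ x y z w → x · - z + y · - w ≡ - (x · z + y · w)
  entry = solve-∀

module _ {q : ℕ} where

  ≈M-refl : ∀ A → A ≈M[ q ] A
  ≈M-refl (mat a b c d) = mod-refl a , mod-refl b , mod-refl c , mod-refl d

  ≈M-sym : ∀ A B → A ≈M[ q ] B → B ≈M[ q ] A
  ≈M-sym (mat a b c d) (mat a′ b′ c′ d′) (a≡ , b≡ , c≡ , d≡) =
    mod-sym a a′ a≡ , mod-sym b b′ b≡ , mod-sym c c′ c≡ , mod-sym d d′ d≡

  ≈M-trans : ∀ A B C → A ≈M[ q ] B → B ≈M[ q ] C → A ≈M[ q ] C
  ≈M-trans (mat a b c d) (mat a′ b′ c′ d′) (mat a″ b″ c″ d″)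
           (a≡ , b≡ , c≡ , d≡) (a≡′ , b≡′ , c≡′ , d≡′) =
    mod-trans a a′ a″ a≡ a≡′ , mod-trans b b′ b″ b≡ b≡′ ,
    mod-trans c c′ c″ c≡ c≡′ , mod-trans d d′ d″ d≡ d≡′

  ≈M-setoid : Setoid _ _
  ≈M-setoid = record
    { Carrier = Mat
    ; _≈_ = _≈M[ q ]_
    ; isEquivalence = record
      { refl = λ {A} → ≈M-refl A
      ; sym = λ {A} {B} → ≈M-sym A B
      ; trans = λ {A} {B} {C} → ≈M-trans A B C
      }
    }

  ⊗-cong : ∀ A A′ B B′ → A ≈M[ q ] A′ → B ≈M[ q ] B′ → A ⊗ B ≈M[ q ] A′ ⊗ B′
  ⊗-cong (mat a b c d) (mat a′ b′ c′ d′) (mat e f g h) (mat e′ f′ g′ h′)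
         (a≡ , b≡ , c≡ , d≡) (e≡ , f≡ , g≡ , h≡) =
    entry a b a′ b′ e g e′ g′ a≡ b≡ e≡ g≡ , entry a b a′ b′ f h f′ h′ a≡ b≡ f≡ h≡ ,
    entry c d c′ d′ e g e′ g′ c≡ d≡ e≡ g≡ , entry c d c′ d′ f h f′ h′ c≡ d≡ f≡ h≡
    where
    entry : ∀ x y x′ y′ z w z′ w′ → x ≡[ q ] x′ → y ≡[ q ] y′ → z ≡[ q ] z′ → w ≡[ q ] w′ →
            x · z + y · w ≡[ q ] x′ · z′ + y′ · w′
    entry x y x′ y′ z w z′ w′ x≡ y≡ z≡ w≡ =
      mod-+-cong (x · z) (x′ · z′) (y · w) (y′ · w′)
        (mod-*-cong x x′ z z′ x≡ z≡) (mod-*-cong y y′ w w′ y≡ w≡)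

  negM-cong : ∀ A B → A ≈M[ q ] B → negM A ≈M[ q ] negM B
  negM-cong (mat a b c d) (mat a′ b′ c′ d′) (a≡ , b≡ , c≡ , d≡) =
    mod-neg-cong a a′ a≡ , mod-neg-cong b b′ b≡ , mod-neg-cong c c′ c≡ , mod-neg-cong d d′ d≡

  scalar≈I : ∀ d → d ≡[ q ] + 1 → scalar d ≈M[ q ] I
  scalar≈I d d≡1 = d≡1 , mod-refl 0ℤ , mod-refl 0ℤ , d≡1

  InSL-⊗ : ∀ A B → InSL q A → InSL q B → InSL q (A ⊗ B)
  InSL-⊗ A B A∈SL B∈SL =
    subst (_≡[ q ] + 1) (sym (det-⊗ A B)) (mod-*-cong (det A) (+ 1) (det B) (+ 1) A∈SL B∈SL)

  open SetoidReasoning ≈M-setoid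

  inv-cancelˡ : ∀ γ B → InSL q γ → inv γ ⊗ (γ ⊗ B) ≈M[ q ] B
  inv-cancelˡ γ B γ∈SL = begin
    inv γ ⊗ (γ ⊗ B)    ≡⟨ ⊗-assoc (inv γ) γ B ⟨
    (inv γ ⊗ γ) ⊗ B    ≡⟨ cong (_⊗ B) (inv-⊗ˡ γ) ⟩
    scalar (det γ) ⊗ B ≈⟨ ⊗-cong (scalar (det γ)) I B B (scalar≈I (det γ) γ∈SL) (≈M-refl B) ⟩
    I ⊗ B              ≡⟨ ⊗-identityˡ B ⟩
    B                  ∎

  inv-⊗-invariant : ∀ γ A B → InSL q γ → inv (γ ⊗ A) ⊗ (γ ⊗ B) ≈M[ q ] inv A ⊗ B
  inv-⊗-invariant γ A B γ∈SL = begin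
    inv (γ ⊗ A) ⊗ (γ ⊗ B)      ≡⟨ cong (_⊗ (γ ⊗ B)) (inv-anti-homo-⊗ γ A) ⟩
    (inv A ⊗ inv γ) ⊗ (γ ⊗ B)  ≡⟨ ⊗-assoc (inv A) (inv γ) (γ ⊗ B) ⟩
    inv A ⊗ (inv γ ⊗ (γ ⊗ B))  ≈⟨ ⊗-cong (inv A) (inv A) _ B (≈M-refl (inv A)) (inv-cancelˡ γ B γ∈SL) ⟩
    inv A ⊗ B                  ∎

  ~-respˡ-≈M : ∀ A B C → A ≈M[ q ] B → B ~[ q ] C → A ~[ q ] C
  ~-respˡ-≈M A B C A≈B (inj₁ B≈C)  = inj₁ (≈M-trans A B C A≈B B≈C)
  ~-respˡ-≈M A B C A≈B (inj₂ B≈-C) = inj₂ (≈M-trans A B (negM C) A≈B B≈-C)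

  ~-respʳ-≈M : ∀ A B C → A ~[ q ] B → B ≈M[ q ] C → A ~[ q ] C
  ~-respʳ-≈M A B C (inj₁ A≈B)  B≈C = inj₁ (≈M-trans A B C A≈B B≈C)
  ~-respʳ-≈M A B C (inj₂ A≈-B) B≈C = inj₂ (≈M-trans A (negM B) (negM C) A≈-B (negM-cong B C B≈C))

  ⊗-congˡ-~ : ∀ C A B → A ~[ q ] B → C ⊗ A ~[ q ] C ⊗ B
  ⊗-congˡ-~ C A B (inj₁ A≈B)  = inj₁ (⊗-cong C C A B (≈M-refl C) A≈B)
  ⊗-congˡ-~ C A B (inj₂ A≈-B) = inj₂ (begin
    C ⊗ A         ≈⟨ ⊗-cong C C A (negM B) (≈M-refl C) A≈-B ⟩
    C ⊗ negM B    ≡⟨ ⊗-negMʳ C B ⟩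
    negM (C ⊗ B)  ∎)

  ⊗-congʳ-~ : ∀ C A B → A ~[ q ] B → A ⊗ C ~[ q ] B ⊗ C
  ⊗-congʳ-~ C A B (inj₁ A≈B)  = inj₁ (⊗-cong A B C C A≈B (≈M-refl C))
  ⊗-congʳ-~ C A B (inj₂ A≈-B) = inj₂ (begin
    A ⊗ C         ≈⟨ ⊗-cong A (negM B) C C A≈-B (≈M-refl C) ⟩
    negM B ⊗ C    ≡⟨ ⊗-negMˡ B C ⟩
    negM (B ⊗ C)  ∎)

  ⊗-fixes⇒~I : ∀ γ A → InSL q A → γ ⊗ A ~[ q ] A → γ ~[ q ] I
  ⊗-fixes⇒~I γ A A∈SL γA~A =
    ~-respˡ-≈M γ ((γ ⊗ A) ⊗ inv A) I γ≈γA·A⁻¹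
      (~-respʳ-≈M ((γ ⊗ A) ⊗ inv A) (A ⊗ inv A) I (⊗-congʳ-~ (inv A) (γ ⊗ A) A γA~A) A·A⁻¹≈I)
    where
    A·A⁻¹≈I : A ⊗ inv A ≈M[ q ] I
    A·A⁻¹≈I = begin
      A ⊗ inv A       ≡⟨ inv-⊗ʳ A ⟩
      scalar (det A)  ≈⟨ scalar≈I (det A) A∈SL ⟩
      I               ∎

    γ≈γA·A⁻¹ : γ ≈M[ q ] (γ ⊗ A) ⊗ inv A
    γ≈γA·A⁻¹ = begin
      γ                ≡⟨ ⊗-identityʳ γ ⟨
      γ ⊗ I            ≈⟨ ⊗-cong γ γ I (A ⊗ inv A) (≈M-refl γ) (≈M-sym (A ⊗ inv A) I A·A⁻¹≈I) ⟩
      γ ⊗ (A ⊗ inv A)  ≡⟨ ⊗-assoc γ A (inv A) ⟨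
      (γ ⊗ A) ⊗ inv A  ∎

InLPS-resp : ∀ q j₀ c₀ p → InLPS q j₀ c₀ p Respects _≈M[ q ]_
InLPS-resp q j₀ c₀ p {g} {g′} g≈g′ (a , b , c , d , norm≡p , a-odd , g~α) =
  a , b , c , d , norm≡p , a-odd ,
  ~-respˡ-≈M g′ g (quatMat j₀ c₀ a b c d) (≈M-sym g g′ g≈g′) g~α

actV-InM : ∀ {q r} γ u → InSL q γ → InM q r u → InM q r (actV γ u)
actV-InM γ (g , x) γ∈SL (g∈SL , x∈H) = InSL-⊗ γ g γ∈SL g∈SL , x∈H

module LeftTranslation {q k : ℕ} (γ : Mat) (γ∈SL : InSL q γ) where

  sig-actF : ∀ (f : Face k) x i → sig (actF γ f) x i ≈M[ q ] sig f x i
  sig-actF f x i = inv-⊗-invariant γ (f x) (f (flip x i)) γ∈SL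

  actF-≈S : ∀ (f : Face k) σ → sig f ≈S[ q ] σ → sig (actF γ f) ≈S[ q ] σ
  actF-≈S f σ f≈σ x i =
    ~-respˡ-≈M (sig (actF γ f) x i) (sig f x i) (σ x i) (sig-actF f x i) (f≈σ x i)

  actF-inv : ∀ (f : Face k) → actF (inv γ) (actF γ f) ≈F[ q ] f
  actF-inv f x = inj₁ (inv-cancelˡ γ (f x) γ∈SL)

  actF-fixes⇒~I : ∀ (f : Face k) → (∀ x → InSL q (f x)) → actF γ f ≈F[ q ] f → γ ~[ q ] I
  actF-fixes⇒~I f f∈SL γf≈f = ⊗-fixes⇒~I γ (f x) (f∈SL x) (γf≈f x)
    where x = replicate k false

  module _ {A : Fin k → Mat → Set} (A-resp : ∀ i → A i Respects _≈M[ q ]_) where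

    actF-IsFace : ∀ f → IsFace q k A f → IsFace q k A (actF γ f)
    actF-IsFace f (f∈SL , f-steps) =
      (λ x → InSL-⊗ γ (f x) γ∈SL (f∈SL x)) ,
      (λ x i → A-resp i (≈M-sym (sig (actF γ f) x i) (sig f x i) (sig-actF f x i)) (f-steps x i))

    module _ {D : ℕ} (S : Fin D → Sig k) where

      actF-InSide : ∀ f → InSide q k A S f → InSide q k A S (actF γ f)
      actF-InSide f (f-face , i , f≈Sᵢ) = actF-IsFace f f-face , i , actF-≈S f (S i) f≈Sᵢ

      actF-IsNbr : ∀ u i f → IsNbr q k A S u i f → IsNbr q k A S (actV γ u) i (actF γ f)
      actF-IsNbr (g , x) i f (f-face , fₓ~g , f≈Sᵢ) =
        actF-IsFace f f-face , ⊗-congˡ-~ γ (f x) g fₓ~g , actF-≈S f (S i) f≈Sᵢ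

propositionA3 :
    (r q : ℕ) (p p′ : Fin (2 ^ r) → ℕ) →
    -- q, all p i, all p′ i are primes ≡ 1 (mod 4)
    Prime q → q % 4 ≡ 1 →
    (∀ i → Prime (p i)) → (∀ i → p i % 4 ≡ 1) →
    (∀ i → Prime (p′ i)) → (∀ i → p′ i % 4 ≡ 1) →
    -- the 2k+1 primes are distinct
    (∀ i j → p i ≡ p j → i ≡ j) → (∀ i j → p′ i ≡ p′ j → i ≡ j) →
    (∀ i j → p i ≢ p′ j) → (∀ i → p i ≢ q) → (∀ i → p′ i ≢ q) →
    -- each p i, p′ i is a quadratic residue mod q
    (∀ i → ∃ λ (y : ℤ) → (y ℤ.* y) ≡[ q ] + p i) →
    (∀ i → ∃ λ (y : ℤ) → (y ℤ.* y) ≡[ q ] + p′ i) →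
    -- q > 2 √(∏ p i),  q > 2 √(∏ p′ i)
    4 * product (tabulate p) < q * q →
    4 * product (tabulate p′) < q * q →
    -- choices j0 with j0² = -1 and c_p with c_p² p = 1 in F_q
    (j0 : ℤ) → (j0 ℤ.* j0) ≡[ q ] (- + 1) →
    (c c′ : Fin (2 ^ r) → ℤ) →
    (∀ i → (c i ℤ.* c i ℤ.* + p i) ≡[ q ] + 1) →
    (∀ i → (c′ i ℤ.* c′ i ℤ.* + p′ i) ≡[ q ] + 1) →
    let k = 2 ^ r
        A  = λ (i : Fin k) → InLPS q j0 (c i) (p i)
        A′ = λ (i : Fin k) → InLPS q j0 (c′ i) (p′ i)
    in
    -- S_L = {ℓ_1,…,ℓ_{D_L}} distinct signatures of faces of X
    (DL : ℕ) (ℓ : Fin DL → Sig k) →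
    (∀ i → IsSigOfFace q k A (ℓ i)) →
    (∀ i j → ℓ i ≈S[ q ] ℓ j → i ≡ j) →
    -- S_R = {r_1,…,r_{D_R}} distinct signatures of faces of X′
    (DR : ℕ) (ρ : Fin DR → Sig k) →
    (∀ i → IsSigOfFace q k A′ (ρ i)) →
    (∀ i j → ρ i ≈S[ q ] ρ j → i ≡ j) →
    -- the bipartite graph H on [D_L] ⊔ [D_R]
    (H : Fin DL → Fin DR → Bool) →
    -- conclusion, for every γ ∈ Γ
    (γ : Mat) → InSL q γ →
      -- γ maps L to L and R to R
      ((∀ f → InSide q k A ℓ f → InSide q k A ℓ (actF γ f))
      × (∀ f → InSide q k A′ ρ f → InSide q k A′ ρ (actF γ f)))
      -- γ acts bijectively on vertices of Z (γ⁻¹ undoes γ)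
      × ((∀ f → InSide q k A ℓ f → actF (inv γ) (actF γ f) ≈F[ q ] f)
      × (∀ f → InSide q k A′ ρ f → actF (inv γ) (actF γ f) ≈F[ q ] f))
      -- the edge of Z indexed by (u,i,j), between LNbr_u(i) and RNbr_u(j),
      -- is mapped to the edge indexed by (γu,i,j)
      × (∀ u i j → InM q r u → H i j ≡ true → ∀ f g →
           IsNbr q k A ℓ u i f → IsNbr q k A′ ρ u j g →
           InM q r (actV γ u)
           × IsNbr q k A ℓ (actV γ u) i (actF γ f)
           × IsNbr q k A′ ρ (actV γ u) j (actF γ g))
      -- freeness: only the identity fixes a vertex of Z
      × ((∀ f → InSide q k A ℓ f → actF γ f ≈F[ q ] f → γ ~[ q ] I)
      × (∀ f → InSide q k A′ ρ f → actF γ f ≈F[ q ] f → γ ~[ q ] I))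
propositionA3 r q p p′ _ _ _ _ _ _ _ _ _ _ _ _ _ _ _ j0 _ c c′ _ _ _ ℓ _ _ _ ρ _ _ _ γ γ∈SL =
  (actF-InSide A-resp ℓ , actF-InSide A′-resp ρ) ,
  ((λ f _ → actF-inv f) , (λ f _ → actF-inv f)) ,
  (λ u i j u∈M _ f g f-nbr g-nbr →
     actV-InM γ u γ∈SL u∈M ,
     actF-IsNbr A-resp ℓ u i f f-nbr ,
     actF-IsNbr A′-resp ρ u j g g-nbr) ,
  ((λ { f ((f∈SL , _) , _) → actF-fixes⇒~I f f∈SL }) ,
   (λ { f ((f∈SL , _) , _) → actF-fixes⇒~I f f∈SL }))
  where
  open LeftTranslation {q} {2 ^ r} γ γ∈SL

  A-resp : ∀ i → InLPS q j0 (c i) (p i) Respects _≈M[ q ]_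
  A-resp i {g} {g′} = InLPS-resp q j0 (c i) (p i) {g} {g′}

  A′-resp : ∀ i → InLPS q j0 (c′ i) (p′ i) Respects _≈M[ q ]_
  A′-resp i {g} {g′} = InLPS-resp q j0 (c′ i) (p′ i) {g} {g′}
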